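{- Let $G=K_{r_1,\ldots,r_k}$ be a complete $k$-partite graph and let $C$ be a set of at least $2k-1$ colors. If, in the graph coloring game on $G$ with color set $C$, Alice plays according to strategy $(A1)$, then, whatever Bob does, the game ends with every vertex of $G$ colored (i.e. Alice wins).
   Context: Graph coloring game: given a graph $G$ and a finite set $C$ of colors, Alice and Bob alternately (Alice first) pick an uncolored vertex and give it a legal color, i.e. a color from $C$ not used on any neighbor of that vertex. The game ends when all vertices are colored (Alice wins) or when no uncolored vertex has a legal color (Bob wins). $K_{r_1,\ldots,r_k}$ denotes the complete $k$-partite graph whose vertex set is partitioned into independent sets (parts) $V_1,\ldots,V_k$ with $|V_i|=r_i\ge 1$, $r_1\ge r_2\ge\cdots\ge r_k$, and any two vertices in different parts adjacent; the paper assumes that if $k\ge 2$ then $r_1\ge 2$. A part is uncolored if none of its vertices is colored, partially colored if some but not all are colored, fully colored if all are colored. A "new color" is a color of $C$ not yet used on any vertex. Strategy $(A1)$ for Alice: on each of her moves, if there is an uncolored part, pick any vertex in any uncolored part and assign to it a new color; otherwise pick any uncolored vertex in any partially colored part $V_i$ and give it a color already used on some vertex of $V_i$. -}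

module Defs where

open import Data.Nat using (ℕ; _≤_)
open import Data.Fin using (Fin)
open import Data.Maybe using (Maybe; just; nothing)
open import Data.Product using (Σ; ∃; ∃-syntax; _×_; _,_; proj₁)
open import Relation.Binary.PropositionalEquality using (_≡_; _≢_)
open import Relation.Nullary using (¬_)

-- The complete k-partite graph K_{r_1,...,r_k}: part i : Fin k has r i vertices.
-- A vertex is a pair (part index, index inside the part).
Vertex : (k : ℕ) → (Fin k → ℕ) → Set
Vertex k r = Σ (Fin k) (λ i → Fin (r i))

Adj : {k : ℕ} {r : Fin k → ℕ} → Vertex k r → Vertex k r → Set
Adj u v = proj₁ u ≢ proj₁ v

-- A (partial) coloring with color set C = Fin c: nothing = uncolored.
Coloring : (k : ℕ) → (Fin k → ℕ) → ℕ → Set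
Coloring k r c = Vertex k r → Maybe (Fin c)

module _ {k : ℕ} {r : Fin k → ℕ} {c : ℕ} where

  emptyColoring : Coloring k r c
  emptyColoring _ = nothing

  Complete : Coloring k r c → Set
  Complete s = ∀ v → ∃[ a ] (s v ≡ just a)

  LegalColor : Coloring k r c → Vertex k r → Fin c → Set
  LegalColor s v a = (s v ≡ nothing) × (∀ u → Adj u v → s u ≢ just a)

  Move : Coloring k r c → Vertex k r → Fin c → Coloring k r c → Set
  Move s v a s' = LegalColor s v a × (s' v ≡ just a) × (∀ u → u ≢ v → s' u ≡ s u)

  LegalMove : Coloring k r c → Coloring k r c → Set
  LegalMove s s' = ∃[ v ] ∃[ a ] Move s v a s'

  UncoloredPart : Coloring k r c → Fin k → Set
  UncoloredPart s i = ∀ j → s (i , j) ≡ nothing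

  PartiallyColoredPart : Coloring k r c → Fin k → Set
  PartiallyColoredPart s i = (∃[ j ] (s (i , j) ≡ nothing)) × (∃[ j ] ∃[ a ] (s (i , j) ≡ just a))

  NewColor : Coloring k r c → Fin c → Set
  NewColor s a = ∀ u → s u ≢ just a

  A1Move : Coloring k r c → Coloring k r c → Set
  A1Move s s' = ∃[ v ] ∃[ a ] (Move s v a s'
    × ((∃[ i ] UncoloredPart s i) → UncoloredPart s (proj₁ v) × NewColor s a)
    × (¬ (∃[ i ] UncoloredPart s i) →
         PartiallyColoredPart s (proj₁ v) × ∃[ j ] (s (proj₁ v , j) ≡ just a)))

  data Player : Set where
    alice bob : Player

  -- positions reachable when Alice (moving first) follows (A1) and Bob plays arbitrary legal moves;
  -- the Player index says who is to move.
  data Reachable : Player → Coloring k r c → Set where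
    start     : Reachable alice emptyColoring
    aliceStep : ∀ {s s'} → Reachable alice s → A1Move s s' → Reachable bob s'
    bobStep   : ∀ {s s'} → Reachable bob s → LegalMove s s' → Reachable alice s'

  CanMove : Player → Coloring k r c → Set
  CanMove alice s = ∃[ s' ] A1Move s s'
  CanMove bob s = ∃[ s' ] LegalMove s s'

-- Under (A1) every color class stays inside a single part, so an uncolored vertex of a part
-- that already carries a color can always reuse that color. While some part is still
-- uncolored, each move of Alice colors a vertex of a fresh part; hence after t rounds at least
-- t parts carry colors and at most 2t colors are used. An uncolored part forces t ≤ k - 1,
-- so at most 2k - 2 < |C| colors are used and a new color is available.
module Submission where

open import Defs
open import Data.Nat using (ℕ; _≤_; _<_; _*_; _∸_; suc; s≤s; z≤n)
open import Data.Nat.Properties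
  using (<⇒≤; <-irrefl; <-≤-trans; n<1+n; *-suc; *-monoʳ-≤; ∸-monoˡ-≤; module ≤-Reasoning)
open import Data.Fin using (Fin; toℕ; zero; suc; fromℕ<)
open import Data.Fin.Properties using (_≟_; any?; all?; ¬∀⟶∃¬; injective⇒≤)
open import Data.Vec.Functional using (Vector; _∷_)
open import Data.Maybe using (Maybe; just; nothing)
open import Data.Maybe.Properties using (just-injective)
open import Data.Product using (∃-syntax; _×_; _,_; proj₁; proj₂)
open import Data.Product.Properties using (≡-dec)
open import Data.Sum using (_⊎_; inj₁; inj₂)
open import Data.Empty using (⊥-elim)
open import Function.Definitions using (Injective)
open import Relation.Binary.Definitions using (DecidableEquality)
open import Relation.Binary.PropositionalEquality using (_≡_; _≢_; refl; sym; trans; cong; subst)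
open import Relation.Nullary using (¬_; Dec; yes; no)
open import Relation.Nullary.Decidable using (decidable-stable)

private
  variable
    A : Set
    m n : ℕ

just? : (x : Maybe A) → Dec (∃[ a ] x ≡ just a)
just? (just a) = yes (a , refl)
just? nothing  = no λ ()

¬just⇒nothing : (x : Maybe A) → ¬ (∃[ a ] x ≡ just a) → x ≡ nothing
¬just⇒nothing (just a) ¬j = ⊥-elim (¬j (a , refl))
¬just⇒nothing nothing  _  = refl

∷-preserves-injective : {f : Vector A n} {a : A} →
                        (∀ x → f x ≢ a) → Injective _≡_ _≡_ f → Injective _≡_ _≡_ (a ∷ f)
∷-preserves-injective _     _     {zero}  {zero}  _ = refl
∷-preserves-injective fresh _     {zero}  {suc y} e = ⊥-elim (fresh y (sym e))
∷-preserves-injective fresh _     {suc x} {zero}  e = ⊥-elim (fresh x e)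
∷-preserves-injective _     f-inj {suc x} {suc y} e = cong suc (f-inj e)

<⇒∃-missed : m < n → (f : Fin m → Fin n) → ∃[ y ] ∀ x → f x ≢ y
<⇒∃-missed {m} {n} m<n f =
  let y , ¬hit = ¬∀⟶∃¬ n (λ y → ∃[ x ] f x ≡ y) (λ y → any? (λ x → f x ≟ y)) all-hit⇒n≤m
  in  y , λ x e → ¬hit (x , e)
  where
  all-hit⇒n≤m : ¬ (∀ y → ∃[ x ] f x ≡ y)
  all-hit⇒n≤m hit = <-irrefl refl (<-≤-trans m<n (injective⇒≤ section-injective))
    where
    section-injective : Injective _≡_ _≡_ (λ y → proj₁ (hit y))
    section-injective {y} {y′} e = trans (sym (proj₂ (hit y))) (trans (cong f e) (proj₂ (hit y′)))

module _ {k : ℕ} {r : Fin k → ℕ} {c : ℕ} where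

  private
    V : Set
    V = Vertex k r

    Col : Set
    Col = Coloring k r c

  _≟V_ : DecidableEquality V
  _≟V_ = ≡-dec _≟_ _≟_

  Touched : Col → Fin k → Set
  Touched s i = ∃[ j ] ∃[ a ] s (i , j) ≡ just a

  ColorClassesWithinParts : Col → Set
  ColorClassesWithinParts s = ∀ u w a → s u ≡ just a → s w ≡ just a → proj₁ u ≡ proj₁ w

  UsedColorsAmong : Col → Vector (Fin c) m → Set
  UsedColorsAmong s palette = ∀ u b → s u ≡ just b → ∃[ x ] palette x ≡ b

  touched≢uncolored : ∀ {s i i′} → Touched s i → UncoloredPart s i′ → i ≢ i′
  touched≢uncolored (j , a , e) unc refl with trans (sym e) (unc j)
  ... | ()

  uncolored-or-touched : ∀ s i → UncoloredPart s i ⊎ Touched s i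
  uncolored-or-touched s i with any? (λ j → just? (s (i , j)))
  ... | yes t  = inj₂ t
  ... | no ¬t  = inj₁ λ j → ¬just⇒nothing _ λ (a , e) → ¬t (j , a , e)

  uncolored-vertex : ∀ {s : Col} → ¬ Complete s → ∃[ v ] s v ≡ nothing
  uncolored-vertex {s} ¬complete =
    let i , ¬i = ¬∀⟶∃¬ k (λ i → ∀ j → Colored (i , j)) (λ i → all? λ j → just? (s (i , j)))
                   λ all → ¬complete λ (i , j) → all i j
        j , ¬j = ¬∀⟶∃¬ (r i) (λ j → Colored (i , j)) (λ j → just? (s (i , j))) ¬i
    in  (i , j) , ¬just⇒nothing _ ¬j
    where
    Colored : V → Set
    Colored v = ∃[ a ] s v ≡ just a

  legal-color⇒same-part : ∀ {s : Col} {u v a} → LegalColor s v a → s u ≡ just a → proj₁ u ≡ proj₁ v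
  legal-color⇒same-part {u = u} {v} (_ , not-on-neighbours) su =
    decidable-stable (proj₁ u ≟ proj₁ v) λ u~v → not-on-neighbours u u~v su

  module _ {s s′ : Col} {v : V} {a : Fin c} (mv : Move s v a s′) where

    private
      s[v]≡nothing : s v ≡ nothing
      s[v]≡nothing = proj₁ (proj₁ mv)

      s′[v]≡a : s′ v ≡ just a
      s′[v]≡a = proj₁ (proj₂ mv)

      s′≗s-off-v : ∀ u → u ≢ v → s′ u ≡ s u
      s′≗s-off-v = proj₂ (proj₂ mv)

    colored-after-move : ∀ u {b} → s u ≡ just b → s′ u ≡ just b
    colored-after-move u e with u ≟V v
    ... | no u≢v  = trans (s′≗s-off-v u u≢v) e
    ... | yes refl with trans (sym s[v]≡nothing) e
    ...   | ()

    uncolored-before-move : ∀ u → s′ u ≡ nothing → s u ≡ nothing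
    uncolored-before-move u e with u ≟V v
    ... | yes refl = s[v]≡nothing
    ... | no u≢v   = trans (sym (s′≗s-off-v u u≢v)) e

    color-after-move : ∀ u {b} → s′ u ≡ just b → (u ≡ v × b ≡ a) ⊎ s u ≡ just b
    color-after-move u e with u ≟V v
    ... | yes refl = inj₁ (refl , just-injective (trans (sym e) s′[v]≡a))
    ... | no u≢v   = inj₂ (trans (sym (s′≗s-off-v u u≢v)) e)

    touched-after-move : ∀ {i} → Touched s i → Touched s′ i
    touched-after-move (j , b , e) = j , b , colored-after-move _ e

    uncolored-part-before-move : ∀ {i} → UncoloredPart s′ i → UncoloredPart s i
    uncolored-part-before-move unc j = uncolored-before-move _ (unc j)

    used-colors-after-move : ∀ {palette : Vector (Fin c) m} →
                             UsedColorsAmong s palette → UsedColorsAmong s′ (a ∷ palette)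
    used-colors-after-move covers u b e with color-after-move u e
    ... | inj₁ (_ , refl) = zero , refl
    ... | inj₂ su         = let x , px = covers u b su in suc x , px

    colorClassesWithinParts-after-move : ColorClassesWithinParts s → ColorClassesWithinParts s′
    colorClassesWithinParts-after-move within u w b eu ew
      with color-after-move u eu | color-after-move w ew
    ... | inj₁ (refl , _)    | inj₁ (refl , _)    = refl
    ... | inj₁ (refl , refl) | inj₂ sw            = sym (legal-color⇒same-part (proj₁ mv) sw)
    ... | inj₂ su            | inj₁ (refl , refl) = legal-color⇒same-part (proj₁ mv) su
    ... | inj₂ su            | inj₂ sw            = within u w b su sw

  -- Before Alice's move at most 2t colors are used on t touched parts, before Bob's at most 2t - 1.
  ColorsPerPart : Player {k} {r} {c} → ℕ → ℕ → Set
  ColorsPerPart alice colors parts = colors ≤ 2 * parts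
  ColorsPerPart bob   colors parts = colors < 2 * parts

  ColorsPerPart⇒≤ : ∀ p {colors parts} → ColorsPerPart p colors parts → colors ≤ 2 * parts
  ColorsPerPart⇒≤ alice b = b
  ColorsPerPart⇒≤ bob   b = <⇒≤ b

  record Budget (p : Player {k} {r} {c}) (s : Col) : Set where
    field
      parts          : ℕ
      part           : Vector (Fin k) parts
      part-injective : Injective _≡_ _≡_ part
      part-touched   : ∀ x → Touched s (part x)
      colors         : ℕ
      palette        : Vector (Fin c) colors
      palette-covers : UsedColorsAmong s palette
      bounded        : ColorsPerPart p colors parts

  open Budget

  empty-budget : Budget alice emptyColoring
  empty-budget = record
    { parts = 0 ; part = λ () ; part-injective = λ {} ; part-touched = λ ()
    ; colors = 0 ; palette = λ () ; palette-covers = λ _ _ () ; bounded = z≤n }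

  budget-after-bob : ∀ {s s′ : Col} {v a} → Budget bob s → Move s v a s′ → Budget alice s′
  budget-after-bob b mv = record
    { parts = parts b ; part = part b ; part-injective = part-injective b
    ; part-touched = λ x → touched-after-move mv (part-touched b x)
    ; colors = suc (colors b) ; palette = _ ∷ palette b
    ; palette-covers = used-colors-after-move mv (palette-covers b)
    ; bounded = bounded b }

  fresh-part-injective : ∀ {p} {s : Col} {i} (b : Budget p s) → UncoloredPart s i →
                         Injective _≡_ _≡_ (i ∷ part b)
  fresh-part-injective b unc =
    ∷-preserves-injective (λ x → touched≢uncolored (part-touched b x) unc) (part-injective b)

  budget-after-alice : ∀ {s s′ : Col} {v a} → Budget alice s → Move s v a s′ →
                       UncoloredPart s (proj₁ v) → Budget bob s′
  budget-after-alice {v = v} b mv unc = record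
    { parts = suc (parts b) ; part = proj₁ v ∷ part b
    ; part-injective = fresh-part-injective b unc
    ; part-touched = λ { zero → proj₂ v , _ , proj₁ (proj₂ mv)
                       ; (suc x) → touched-after-move mv (part-touched b x) }
    ; colors = suc (colors b) ; palette = _ ∷ palette b
    ; palette-covers = used-colors-after-move mv (palette-covers b)
    ; bounded = subst (suc (colors b) <_) (sym (*-suc 2 (parts b))) (s≤s (s≤s (bounded b))) }

  new-color-exists : ∀ {p} {s : Col} {i} → 2 * k ∸ 1 ≤ c → Budget p s → UncoloredPart s i →
                     ∃[ a ] NewColor s a
  new-color-exists {p} {s} hc b unc =
    let a , missed = <⇒∃-missed colors<c (palette b)
    in  a , λ u su → let x , px = palette-covers b u a su in missed x px
    where
    open ≤-Reasoning
    colors<c : colors b < c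
    colors<c = begin-strict
      colors b                  ≤⟨ ColorsPerPart⇒≤ p (bounded b) ⟩
      2 * parts b               <⟨ n<1+n _ ⟩
      suc (2 * parts b)         ≡⟨ cong (_∸ 1) (*-suc 2 (parts b)) ⟨
      2 * suc (parts b) ∸ 1     ≤⟨ ∸-monoˡ-≤ 1 (*-monoʳ-≤ 2 (injective⇒≤ (fresh-part-injective b unc))) ⟩
      2 * k ∸ 1                 ≤⟨ hc ⟩
      c                         ∎

  Invariant : Player {k} {r} {c} → Col → Set
  Invariant p s = ColorClassesWithinParts s × ((∃[ i ] UncoloredPart s i) → Budget p s)

  reachable⇒invariant : ∀ {p s} → Reachable p s → Invariant p s
  reachable⇒invariant start = (λ _ _ _ ()) , λ _ → empty-budget
  reachable⇒invariant (aliceStep reach (_ , _ , mv , uncolored⇒fresh , _)) =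
    let within , budget = reachable⇒invariant reach in
    colorClassesWithinParts-after-move mv within , λ (i , unc) →
      let unc-before = i , uncolored-part-before-move mv unc
      in  budget-after-alice (budget unc-before) mv (proj₁ (uncolored⇒fresh unc-before))
  reachable⇒invariant (bobStep reach (_ , _ , mv)) =
    let within , budget = reachable⇒invariant reach in
    colorClassesWithinParts-after-move mv within , λ (i , unc) →
      budget-after-bob (budget (i , uncolored-part-before-move mv unc)) mv

  recolor : Col → V → Fin c → Col
  recolor s v a u with u ≟V v
  ... | yes _ = just a
  ... | no  _ = s u

  move-exists : ∀ {s : Col} {v a} → LegalColor s v a → ∃[ s′ ] Move s v a s′
  move-exists {s} {v} {a} legal = recolor s v a , legal , recolor-at-v , recolor-off-v
    where
    recolor-at-v : recolor s v a v ≡ just a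
    recolor-at-v with v ≟V v
    ... | yes _   = refl
    ... | no v≢v  = ⊥-elim (v≢v refl)
    recolor-off-v : ∀ u → u ≢ v → recolor s v a u ≡ s u
    recolor-off-v u u≢v with u ≟V v
    ... | yes u≡v = ⊥-elim (u≢v u≡v)
    ... | no _    = refl

  new-color-legal : ∀ {s : Col} {v a} → NewColor s a → s v ≡ nothing → LegalColor s v a
  new-color-legal new sv = sv , λ u _ → new u

  reused-color-legal : ∀ {s : Col} {v j a} → ColorClassesWithinParts s → s v ≡ nothing →
                       s (proj₁ v , j) ≡ just a → LegalColor s v a
  reused-color-legal within sv e = sv , λ u u~v su → u~v (within u _ _ su e)

  uncolored? : ∀ (s : Col) i → Dec (UncoloredPart s i)
  uncolored? s i with uncolored-or-touched s i
  ... | inj₁ unc = yes unc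
  ... | inj₂ t   = no λ unc → touched≢uncolored {s} t unc refl

  bob-move : ∀ {s : Col} {v a} → LegalColor s v a → CanMove bob s
  bob-move legal = let s′ , mv = move-exists legal in s′ , _ , _ , mv

  bob-can-move : ∀ {s : Col} → 2 * k ∸ 1 ≤ c → Invariant bob s → ¬ Complete s → CanMove bob s
  bob-can-move {s} hc (within , budget) ¬complete with uncolored-vertex ¬complete
  ... | v , sv with uncolored-or-touched s (proj₁ v)
  ...   | inj₂ (_ , _ , e) = bob-move (reused-color-legal within sv e)
  ...   | inj₁ unc         =
    let _ , new = new-color-exists hc (budget (_ , unc)) unc
    in  bob-move (new-color-legal new sv)

  alice-can-move : ∀ {s : Col} → 2 * k ∸ 1 ≤ c → (∀ i → 1 ≤ r i) →
                   Invariant alice s → ¬ Complete s → CanMove alice s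
  alice-can-move {s} hc nonempty (within , budget) ¬complete with any? (uncolored? s)
  ... | yes (i , unc) =
    let a , new  = new-color-exists hc (budget (i , unc)) unc
        s′ , mv = move-exists (new-color-legal {v = i , fromℕ< (nonempty i)} new (unc _))
    in  s′ , _ , a , mv , (λ _ → unc , new) , λ none → ⊥-elim (none (i , unc))
  ... | no none with uncolored-vertex ¬complete
  ...   | v , sv with uncolored-or-touched s (proj₁ v)
  ...     | inj₁ unc         = ⊥-elim (none (_ , unc))
  ...     | inj₂ (j , a , e) =
    let s′ , mv = move-exists (reused-color-legal within sv e)
    in  s′ , v , a , mv , (λ some → ⊥-elim (none some)) , λ _ → ((proj₂ v , sv) , j , a , e) , j , e

lemma1 : (k : ℕ) (r : Fin k → ℕ) (c : ℕ)
    → (∀ i → 1 ≤ r i)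
    → (∀ i j → toℕ i ≤ toℕ j → r j ≤ r i)
    → (2 ≤ k → ∀ i → toℕ i ≡ 0 → 2 ≤ r i)
    → 2 * k ∸ 1 ≤ c
    → ∀ (p : Player) (s : Coloring k r c) → Reachable p s → ¬ Complete s → CanMove p s
lemma1 k r c nonempty _ _ hc alice s reach = alice-can-move hc nonempty (reachable⇒invariant reach)
lemma1 k r c nonempty _ _ hc bob   s reach = bob-can-move hc (reachable⇒invariant reach)
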